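{- Let $X$ be a finite set and let $\tau$ be a non-empty collection of subsets of $X$, each of size at least 3, that is slim. Then the collection $\mathcal{P}$ of non-empty subsets $\tau'\subseteq\tau$ with ${\rm exc}'(\tau')=0$ forms a patchwork.
   Context: $L(\tau')=\bigcup_{s\in\tau'}s$ and ${\rm exc}'(\tau')=|L(\tau')|-2-\sum_{s\in\tau'}(|s|-2)$. The collection $\tau$ is slim if ${\rm exc}'(\tau')\ge 0$ for every non-empty $\tau'\subseteq\tau$. A patchwork is a non-empty collection $\mathcal{P}$ of sets such that whenever $A,B\in\mathcal{P}$ and $A\cap B\neq\emptyset$, both $A\cap B$ and $A\cup B$ belong to $\mathcal{P}$. -}

module Defs where

open import Data.Nat using (ℕ; zero; suc)
open import Data.Bool using (Bool; true; false; _∧_; _∨_; if_then_else_)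
open import Data.Fin using (Fin; zero; suc)
open import Data.Fin.Subset using (Subset; _∈_; _∩_; _∪_; ∣_∣; Nonempty)
open import Data.Vec using (Vec; tabulate; lookup)
open import Data.Integer as ℤ using (ℤ; +_; _-_; _≤_)
open import Data.Product using (_×_; ∃)
open import Relation.Binary.PropositionalEquality using (_≡_)

-- The ground set X is Fin n.  A collection τ of m subsets of X is given
-- as an (injective, see the statement) family  τ : Fin m → Subset n.
-- A sub-collection τ' ⊆ τ is a subset of the index set: σ : Subset m.

anyFin : ∀ {m} → (Fin m → Bool) → Bool
anyFin {zero}  f = false
anyFin {suc m} f = f zero ∨ anyFin (λ i → f (suc i))

sumOver : ∀ {m} → Subset m → (Fin m → ℤ) → ℤ
sumOver {m} σ f = go m (λ i → lookup σ i) f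
  where
  go : ∀ k → (Fin k → Bool) → (Fin k → ℤ) → ℤ
  go zero    b g = + 0
  go (suc k) b g = (if b zero then g zero else (+ 0)) ℤ.+ go k (λ i → b (suc i)) (λ i → g (suc i))

L : ∀ {n m} → (Fin m → Subset n) → Subset m → Subset n
L τ σ = tabulate (λ x → anyFin (λ i → lookup σ i ∧ lookup (τ i) x))

exc′ : ∀ {n m} → (Fin m → Subset n) → Subset m → ℤ
exc′ τ σ = (+ ∣ L τ σ ∣ - + 2) - sumOver σ (λ i → + ∣ τ i ∣ - + 2)

Slim : ∀ {n m} → (Fin m → Subset n) → Set
Slim {m = m} τ = (σ : Subset m) → Nonempty σ → + 0 ≤ exc′ τ σ

Patchwork : ∀ {m} → (Subset m → Set) → Set
Patchwork {m} 𝒫 =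
  ∃ 𝒫 ×
  ((A B : Subset m) → 𝒫 A → 𝒫 B → Nonempty (A ∩ B) → 𝒫 (A ∩ B) × 𝒫 (A ∪ B))

Tight : ∀ {n m} → (Fin m → Subset n) → Subset m → Set
Tight τ σ = Nonempty σ × exc′ τ σ ≡ + 0

-- Slimness says exc′ ≥ 0 on non-empty families, and exc′ is submodular, because the
-- union L is submodular while Σ (|s| - 2) is modular.  So if A and B are tight and
-- meet, 0 ≤ exc′ (A ∩ B) + exc′ (A ∪ B) ≤ exc′ A + exc′ B = 0 forces A ∩ B and A ∪ B
-- to be tight.  Every singleton is tight, so tight families exist.
module Submission where

open import Defs
open import Data.Nat as ℕ using (ℕ; zero; suc; _≤_)
import Data.Nat.Properties as ℕ
open import Data.Bool using (Bool; true; false; _∧_; _∨_; if_then_else_)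
open import Data.Fin using (Fin; zero; suc)
open import Data.Fin.Subset
  using (Subset; inside; outside; _∈_; _⊆_; _∩_; _∪_; ⊥; ⁅_⁆; ∣_∣; Nonempty)
open import Data.Fin.Subset.Properties
  using (⊆-antisym; p⊆q⇒∣p∣≤∣q∣; p⊆p∪q; p∩q⊆p; p∩q⊆q; x∈p∩q⁺; x∈p∪q⁻; x∈p∪q⁺; x∈⁅x⁆; x∈⁅y⁆⇒x≡y)
open import Data.Vec using ([]; _∷_; lookup)
open import Data.Vec.Properties using (lookup∘tabulate; []=⇒lookup; lookup⇒[]=)
open import Data.Integer as ℤ using (ℤ; +_; 0ℤ; _+_; _-_; +≤+)
import Data.Integer.Properties as ℤ
open import Data.Integer.Tactic.RingSolver using (solve-∀)
open import Algebra.Properties.CommutativeSemigroup ℤ.+-commutativeSemigroup using (interchange)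
open import Data.Product using (_×_; _,_; proj₁; proj₂; ∃)
open import Data.Sum using (inj₁; inj₂)
open import Function.Definitions using (Injective)
open import Relation.Binary.PropositionalEquality
  using (_≡_; refl; sym; trans; cong; cong₂; subst; module ≡-Reasoning)

+-suc-cong : ∀ {a b c d} → a ℕ.+ b ≡ c ℕ.+ d → a ℕ.+ suc b ≡ c ℕ.+ suc d
+-suc-cong {a} {b} {c} {d} eq = trans (ℕ.+-suc a b) (trans (cong suc eq) (sym (ℕ.+-suc c d)))

∣p∩q∣+∣p∪q∣≡∣p∣+∣q∣ : ∀ {n} (p q : Subset n) → ∣ p ∩ q ∣ ℕ.+ ∣ p ∪ q ∣ ≡ ∣ p ∣ ℕ.+ ∣ q ∣
∣p∩q∣+∣p∪q∣≡∣p∣+∣q∣ []            []            = refl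
∣p∩q∣+∣p∪q∣≡∣p∣+∣q∣ (outside ∷ p) (outside ∷ q) = ∣p∩q∣+∣p∪q∣≡∣p∣+∣q∣ p q
∣p∩q∣+∣p∪q∣≡∣p∣+∣q∣ (outside ∷ p) (inside  ∷ q) = +-suc-cong (∣p∩q∣+∣p∪q∣≡∣p∣+∣q∣ p q)
∣p∩q∣+∣p∪q∣≡∣p∣+∣q∣ (inside  ∷ p) (outside ∷ q) =
  trans (ℕ.+-suc ∣ p ∩ q ∣ ∣ p ∪ q ∣) (cong suc (∣p∩q∣+∣p∪q∣≡∣p∣+∣q∣ p q))
∣p∩q∣+∣p∪q∣≡∣p∣+∣q∣ (inside  ∷ p) (inside  ∷ q) = cong suc (+-suc-cong (∣p∩q∣+∣p∪q∣≡∣p∣+∣q∣ p q))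

sumOver-⊥ : ∀ {m} (f : Fin m → ℤ) → sumOver ⊥ f ≡ 0ℤ
sumOver-⊥ {zero}  f = refl
sumOver-⊥ {suc m} f = trans (ℤ.+-identityˡ _) (sumOver-⊥ (λ i → f (suc i)))

sumOver-⁅⁆ : ∀ {m} (i : Fin m) (f : Fin m → ℤ) → sumOver ⁅ i ⁆ f ≡ f i
sumOver-⁅⁆ zero    f = trans (cong (_+_ (f zero)) (sumOver-⊥ (λ i → f (suc i)))) (ℤ.+-identityʳ _)
sumOver-⁅⁆ (suc i) f = trans (ℤ.+-identityˡ _) (sumOver-⁅⁆ i (λ j → f (suc j)))

sumOver-modular : ∀ {m} (A B : Subset m) (f : Fin m → ℤ) →
  sumOver (A ∩ B) f + sumOver (A ∪ B) f ≡ sumOver A f + sumOver B f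
sumOver-modular []      []      f = refl
sumOver-modular (a ∷ A) (b ∷ B) f = begin
  (head (a ∧ b) + sumOver (A ∩ B) g) + (head (a ∨ b) + sumOver (A ∪ B) g)
    ≡⟨ interchange (head (a ∧ b)) _ _ _ ⟩
  (head (a ∧ b) + head (a ∨ b)) + (sumOver (A ∩ B) g + sumOver (A ∪ B) g)
    ≡⟨ cong₂ _+_ (head-modular a b) (sumOver-modular A B g) ⟩
  (head a + head b) + (sumOver A g + sumOver B g)
    ≡⟨ interchange (head a) _ _ _ ⟩
  (head a + sumOver A g) + (head b + sumOver B g) ∎
  where
  open ≡-Reasoning
  g : Fin _ → ℤ
  g i = f (suc i)
  head : Bool → ℤ
  head x = if x then f zero else 0ℤ
  head-modular : ∀ a b → head (a ∧ b) + head (a ∨ b) ≡ head a + head b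
  head-modular true  true  = refl
  head-modular true  false = ℤ.+-comm (head false) (head true)
  head-modular false b     = refl

excess-+ : ∀ x y s t →
  ((x - + 2) - s) + ((y - + 2) - t) ≡ ((x + y) - + 4) - (s + t)
excess-+ = solve-∀

nonneg-+≤0⇒≡0 : ∀ {i j} → 0ℤ ℤ.≤ i → 0ℤ ℤ.≤ j → i + j ℤ.≤ 0ℤ → i ≡ 0ℤ × j ≡ 0ℤ
nonneg-+≤0⇒≡0 {+ a} {+ b} (+≤+ _) (+≤+ _) (+≤+ a+b≤0) =
  cong +_ (ℕ.m+n≡0⇒m≡0 a a+b≡0) , cong +_ (ℕ.m+n≡0⇒n≡0 a a+b≡0)
  where a+b≡0 = ℕ.n≤0⇒n≡0 a+b≤0

NonemptyZero : ∀ {m} → (Subset m → ℤ) → Subset m → Set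
NonemptyZero f σ = Nonempty σ × f σ ≡ 0ℤ

nonemptyZeros-patchwork : ∀ {m} (f : Subset m → ℤ) →
  (∀ σ → Nonempty σ → 0ℤ ℤ.≤ f σ) →
  (∀ A B → f (A ∩ B) + f (A ∪ B) ℤ.≤ f A + f B) →
  ∃ (NonemptyZero f) → Patchwork (NonemptyZero f)
nonemptyZeros-patchwork f f-nonneg f-submodular zero-exists = zero-exists , closed
  where
  closed : ∀ A B → NonemptyZero f A → NonemptyZero f B → Nonempty (A ∩ B) →
           NonemptyZero f (A ∩ B) × NonemptyZero f (A ∪ B)
  closed A B ((x , x∈A) , fA≡0) (_ , fB≡0) A∩B≠∅ =
    (A∩B≠∅ , proj₁ both≡0) , (A∪B≠∅ , proj₂ both≡0)
    where
    A∪B≠∅ : Nonempty (A ∪ B)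
    A∪B≠∅ = x , p⊆p∪q B x∈A
    both≡0 : f (A ∩ B) ≡ 0ℤ × f (A ∪ B) ≡ 0ℤ
    both≡0 = nonneg-+≤0⇒≡0 (f-nonneg _ A∩B≠∅) (f-nonneg _ A∪B≠∅)
      (ℤ.≤-trans (f-submodular A B) (ℤ.≤-reflexive (cong₂ _+_ fA≡0 fB≡0)))

anyFin⁺ : ∀ {m} (f : Fin m → Bool) (i : Fin m) → f i ≡ true → anyFin f ≡ true
anyFin⁺ f zero    fi rewrite fi = refl
anyFin⁺ f (suc i) fi with f zero
... | true  = refl
... | false = anyFin⁺ (λ j → f (suc j)) i fi

anyFin⁻ : ∀ {m} (f : Fin m → Bool) → anyFin f ≡ true → ∃ λ i → f i ≡ true
anyFin⁻ {suc _} f any with f zero in f0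
... | true  = zero , f0
... | false with anyFin⁻ (λ j → f (suc j)) any
...   | i , fi = suc i , fi

module _ {n m : ℕ} (τ : Fin m → Subset n) where

  ∈L⁺ : ∀ {σ i x} → i ∈ σ → x ∈ τ i → x ∈ L τ σ
  ∈L⁺ {σ} {i} {x} i∈σ x∈τi = lookup⇒[]= x (L τ σ) (trans (lookup∘tabulate _ x) any)
    where
    any : anyFin (λ j → lookup σ j ∧ lookup (τ j) x) ≡ true
    any = anyFin⁺ _ i (cong₂ _∧_ ([]=⇒lookup i∈σ) ([]=⇒lookup x∈τi))

  ∈L⁻ : ∀ {σ x} → x ∈ L τ σ → ∃ λ i → i ∈ σ × x ∈ τ i
  ∈L⁻ {σ} {x} x∈L
    with anyFin⁻ _ (trans (sym (lookup∘tabulate _ x)) ([]=⇒lookup x∈L))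
  ... | i , σi∧τix≡true with lookup σ i in σi | lookup (τ i) x in τix
  ...   | true | true = i , lookup⇒[]= i σ σi , lookup⇒[]= x (τ i) τix

  L-mono : ∀ {A B} → A ⊆ B → L τ A ⊆ L τ B
  L-mono A⊆B x∈LA with ∈L⁻ x∈LA
  ... | i , i∈A , x∈τi = ∈L⁺ (A⊆B i∈A) x∈τi

  L-∪ : ∀ A B → L τ (A ∪ B) ⊆ L τ A ∪ L τ B
  L-∪ A B x∈L with ∈L⁻ {A ∪ B} x∈L
  ... | i , i∈A∪B , x∈τi with x∈p∪q⁻ A B i∈A∪B
  ...   | inj₁ i∈A = x∈p∪q⁺ (inj₁ (∈L⁺ i∈A x∈τi))
  ...   | inj₂ i∈B = x∈p∪q⁺ (inj₂ (∈L⁺ i∈B x∈τi))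

  L-⁅⁆ : ∀ i → L τ ⁅ i ⁆ ≡ τ i
  L-⁅⁆ i = ⊆-antisym ⊆τi (∈L⁺ (x∈⁅x⁆ i))
    where
    ⊆τi : L τ ⁅ i ⁆ ⊆ τ i
    ⊆τi x∈L with ∈L⁻ x∈L
    ... | j , j∈⁅i⁆ , x∈τj = subst (λ k → _ ∈ τ k) (x∈⁅y⁆⇒x≡y i j∈⁅i⁆) x∈τj

  L-∩ : ∀ A B → L τ (A ∩ B) ⊆ L τ A ∩ L τ B
  L-∩ A B x∈L = x∈p∩q⁺ (L-mono (p∩q⊆p A B) x∈L , L-mono (p∩q⊆q A B) x∈L)

  weight : Fin m → ℤ
  weight i = + ∣ τ i ∣ - + 2

  ∣L∣-submodular : ∀ A B → ∣ L τ (A ∩ B) ∣ ℕ.+ ∣ L τ (A ∪ B) ∣ ≤ ∣ L τ A ∣ ℕ.+ ∣ L τ B ∣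
  ∣L∣-submodular A B = begin
    ∣ L τ (A ∩ B) ∣ ℕ.+ ∣ L τ (A ∪ B) ∣
      ≤⟨ ℕ.+-mono-≤ (p⊆q⇒∣p∣≤∣q∣ (L-∩ A B)) (p⊆q⇒∣p∣≤∣q∣ (L-∪ A B)) ⟩
    ∣ L τ A ∩ L τ B ∣ ℕ.+ ∣ L τ A ∪ L τ B ∣
      ≡⟨ ∣p∩q∣+∣p∪q∣≡∣p∣+∣q∣ (L τ A) (L τ B) ⟩
    ∣ L τ A ∣ ℕ.+ ∣ L τ B ∣ ∎
    where open ℕ.≤-Reasoning

  exc′-submodular : ∀ A B → exc′ τ (A ∩ B) + exc′ τ (A ∪ B) ℤ.≤ exc′ τ A + exc′ τ B
  exc′-submodular A B = begin
    exc′ τ (A ∩ B) + exc′ τ (A ∪ B)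
      ≡⟨ excess-+ (∣L∣ (A ∩ B)) (∣L∣ (A ∪ B)) (Σw (A ∩ B)) (Σw (A ∪ B)) ⟩
    ((∣L∣ (A ∩ B) + ∣L∣ (A ∪ B)) - + 4) - (Σw (A ∩ B) + Σw (A ∪ B))
      ≡⟨ cong₂ (λ l s → (l - + 4) - s)
               (sym (ℤ.pos-+ ∣ L τ (A ∩ B) ∣ ∣ L τ (A ∪ B) ∣)) (sumOver-modular A B weight) ⟩
    (+ (∣ L τ (A ∩ B) ∣ ℕ.+ ∣ L τ (A ∪ B) ∣) - + 4) - (Σw A + Σw B)
      ≤⟨ ℤ.+-monoˡ-≤ (ℤ.- (Σw A + Σw B)) (ℤ.+-monoˡ-≤ (ℤ.- + 4) (+≤+ (∣L∣-submodular A B))) ⟩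
    (+ (∣ L τ A ∣ ℕ.+ ∣ L τ B ∣) - + 4) - (Σw A + Σw B)
      ≡⟨ cong (λ l → (l - + 4) - (Σw A + Σw B)) (ℤ.pos-+ ∣ L τ A ∣ ∣ L τ B ∣) ⟩
    ((∣L∣ A + ∣L∣ B) - + 4) - (Σw A + Σw B)
      ≡⟨ excess-+ (∣L∣ A) (∣L∣ B) (Σw A) (Σw B) ⟨
    exc′ τ A + exc′ τ B ∎
    where
    open ℤ.≤-Reasoning
    ∣L∣ : Subset m → ℤ
    ∣L∣ σ = + ∣ L τ σ ∣
    Σw : Subset m → ℤ
    Σw σ = sumOver σ weight

  exc′-⁅⁆ : ∀ i → exc′ τ ⁅ i ⁆ ≡ 0ℤ
  exc′-⁅⁆ i = begin
    (+ ∣ L τ ⁅ i ⁆ ∣ - + 2) - sumOver ⁅ i ⁆ weight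
      ≡⟨ cong₂ (λ s t → (+ ∣ s ∣ - + 2) - t) (L-⁅⁆ i) (sumOver-⁅⁆ i weight) ⟩
    weight i - weight i
      ≡⟨ ℤ.+-inverseʳ (weight i) ⟩
    0ℤ ∎
    where open ≡-Reasoning

corollary3 : (n m : ℕ) → (τ : Fin m → Subset n) →
    1 ≤ m → Injective _≡_ _≡_ τ → ((i : Fin m) → 3 ≤ ∣ τ i ∣) →
    Slim τ → Patchwork (Tight τ)
corollary3 _ (suc _) τ _ _ _ slim =
  nonemptyZeros-patchwork (exc′ τ) slim (exc′-submodular τ)
    (⁅ zero ⁆ , (zero , x∈⁅x⁆ zero) , exc′-⁅⁆ τ zero)
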